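{- Let $r>2$ be an integer and let $G$ be a graph. The Cartesian product $G\,\Box\,K_r$ is an efficient open domination graph if and only if $G$ is a $K_r$-amenable graph.
   Context: All graphs are finite and simple. A graph $X$ is an efficient open domination graph (EOD-graph) if there is a set $D\subseteq V(X)$ (an EOD-set) such that $\bigcup_{v\in D}N(v)=V(X)$ and $N(u)\cap N(v)=\emptyset$ for all distinct $u,v\in D$, where $N(v)$ is the open neighborhood. For $S\subseteq V(G)$, $\langle S\rangle$ is the induced subgraph, and "$\langle S\rangle$ is a matching" means every vertex of $S$ has exactly one neighbor in $S$ (empty $S$ allowed). A weak partition of a set is a collection of pairwise disjoint, possibly empty, subsets whose union is the set. A graph $G$ is $K_r$-amenable if there is a weak partition $\{V_0,V_1,\dots,V_r\}$ of $V(G)$ such that: (A) if $x\in V_0$ then $|N(x)\cap V_i|=1$ for every $i\in\{1,\dots,r\}$; (B) $\langle V_i\rangle$ is a matching for every $i\in\{1,\dots,r\}$; (C) $\langle V_1\cup\cdots\cup V_r\rangle$ is a matching. -}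

module Defs where

open import Data.Nat using (ℕ; suc)
open import Data.Fin using (Fin; zero; suc)
open import Data.Bool using (Bool; true)
open import Data.Product using (Σ; _×_; _,_)
open import Data.Sum using (_⊎_; inj₁; inj₂)
open import Relation.Nullary using (¬_)
open import Relation.Binary.PropositionalEquality as Eq using (_≡_; _≢_; refl)

record Graph (V : Set) : Set₁ where
  field
    Adj    : V → V → Set
    sym    : ∀ {u v} → Adj u v → Adj v u
    irrefl : ∀ {v} → ¬ Adj v v
open Graph public

ExactlyOne : {A : Set} → (A → Set) → Set
ExactlyOne {A} P = Σ A λ y → P y × (∀ z → P z → z ≡ y)

K : (r : ℕ) → Graph (Fin r)
K r = record
  { Adj = λ i j → i ≢ j
  ; sym = λ p q → p (Eq.sym q)
  ; irrefl = λ p → p refl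
  }

_□_ : {V W : Set} → Graph V → Graph W → Graph (V × W)
_□_ {V} {W} G H = record { Adj = A ; sym = s ; irrefl = ir }
  where
  A : V × W → V × W → Set
  A (g , h) (g' , h') = (Adj G g g' × h ≡ h') ⊎ (g ≡ g' × Adj H h h')
  s : ∀ {u v} → A u v → A v u
  s (inj₁ (a , e)) = inj₁ (Graph.sym G a , Eq.sym e)
  s (inj₂ (e , a)) = inj₂ (Eq.sym e , Graph.sym H a)
  ir : ∀ {v} → ¬ A v v
  ir (inj₁ (a , _)) = Graph.irrefl G a
  ir (inj₂ (_ , a)) = Graph.irrefl H a

IsEODSet : {V : Set} → Graph V → (V → Bool) → Set
IsEODSet {V} X D =
  (∀ x → Σ V λ v → D v ≡ true × Adj X v x)
  × (∀ u v → D u ≡ true → D v ≡ true → u ≢ v → ∀ x → ¬ (Adj X u x × Adj X v x))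

IsEOD : {V : Set} → Graph V → Set
IsEOD {V} X = Σ (V → Bool) λ D → IsEODSet X D

-- A weak partition {V_0,...,V_r} of V is given by a labelling p : V → Fin (suc r),
-- V_i = p⁻¹(i).  <S> is a matching: every vertex of S has exactly one neighbour in S.
IsMatchingOn : {V : Set} → Graph V → (V → Set) → Set
IsMatchingOn X S = ∀ x → S x → ExactlyOne (λ y → Adj X x y × S y)

IsAmenablePartition : {V : Set} → (r : ℕ) → Graph V → (V → Fin (suc r)) → Set
IsAmenablePartition r G p =
  -- (A)
  (∀ x → p x ≡ zero → (i : Fin r) → ExactlyOne (λ y → Adj G x y × p y ≡ suc i))
  -- (B)
  × ((i : Fin r) → IsMatchingOn G (λ x → p x ≡ suc i))
  -- (C)
  × IsMatchingOn G (λ x → p x ≢ zero)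

IsAmenable : {V : Set} → (r : ℕ) → Graph V → Set
IsAmenable {V} r G = Σ (V → Fin (suc r)) λ p → IsAmenablePartition r G p

module Submission where

-- Given the partition p : V → Fin (suc r) (class 0 = V₀,
-- class suc i = V_{i+1}), the set D = {(g , h) | g ∈ V_{h+1}} is an EOD-set.
-- The heart of the argument is that every vertex has at most one neighbour
-- in each class V_{i+1} (from (A) for g ∈ V₀, from (C) otherwise), and that a
-- vertex of V_{j+1} has its labelled neighbours only in V_{j+1} ((B) + (C)).
--
-- Given an EOD-set D, label g by suc h if (g , h) ∈ D and by
-- zero otherwise.  This is well defined because, for r ≥ 3, each fibre
-- {g} × K_r contains at most one vertex of D (two of them would share a
-- neighbour in a third coordinate); and two D-vertices in the same layer
-- G × {i} never share a G-neighbour.  Covering the vertex (x , i) then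
-- produces the neighbours required by (A), (B) and (C).

open import Defs hiding (sym; irrefl)
open import Data.Nat using (ℕ; suc; _<_; s≤s)
open import Data.Fin using (Fin; zero; suc; _≟_)
open import Data.Fin.Properties using (any?; suc-injective; 0≢1+n)
open import Data.Bool using (Bool; true)
import Data.Bool.Properties as BoolProps
open import Data.Product using (Σ; _×_; _,_; proj₁; proj₂; ∃)
open import Data.Sum using (inj₁; inj₂)
open import Data.Empty using (⊥; ⊥-elim)
open import Relation.Nullary using (¬_; yes; no; does; contradiction)
open import Relation.Nullary.Decidable using (dec-true)
open import Relation.Binary using (Decidable; DecidableEquality)
open import Relation.Binary.PropositionalEquality
  using (_≡_; _≢_; refl; sym; trans; cong; subst; ≢-sym)
open import Function.Bundles using (_⇔_; mk⇔; Equivalence)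

exactlyOne-unique : {A : Set} {P : A → Set} → ExactlyOne P → ∀ {a b} → P a → P b → a ≡ b
exactlyOne-unique (_ , _ , only) pa pb = trans (only _ pa) (sym (only _ pb))

nonzero-suc : ∀ {r} (f : Fin (suc r)) → f ≢ zero → ∃ λ i → f ≡ suc i
nonzero-suc zero    f≢0 = contradiction refl f≢0
nonzero-suc (suc i) _   = i , refl

thirdElement : ∀ {r} → 2 < r → (a b : Fin r) → ∃ λ c → c ≢ a × c ≢ b
thirdElement (s≤s (s≤s (s≤s _))) = third
  where
  third : ∀ {m} (a b : Fin (suc (suc (suc m)))) → ∃ λ c → c ≢ a × c ≢ b
  third zero          zero          = suc zero       , (λ ()) , (λ ())
  third zero          (suc zero)    = suc (suc zero) , (λ ()) , (λ ())
  third zero          (suc (suc _)) = suc zero       , (λ ()) , (λ ())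
  third (suc zero)    zero          = suc (suc zero) , (λ ()) , (λ ())
  third (suc (suc _)) zero          = suc zero       , (λ ()) , (λ ())
  third (suc _)       (suc _)       = zero           , (λ ()) , (λ ())

module AmenableToEOD {V : Set} {r : ℕ} (G : Graph V) (p : V → Fin (suc r))
                     (amenable : IsAmenablePartition r G p) where

  open Graph G using () renaming (sym to adj-sym)

  condA : ∀ x → p x ≡ zero → (i : Fin r) → ExactlyOne (λ y → Adj G x y × p y ≡ suc i)
  condA = proj₁ amenable

  condB : (i : Fin r) → IsMatchingOn G (λ x → p x ≡ suc i)
  condB = proj₁ (proj₂ amenable)

  condC : IsMatchingOn G (λ x → p x ≢ zero)
  condC = proj₂ (proj₂ amenable)

  D : V × Fin r → Bool
  D (g , h) = does (p g ≟ suc h)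

  D-sound : ∀ {g h} → D (g , h) ≡ true → p g ≡ suc h
  D-sound {g} {h} with p g ≟ suc h
  ... | yes pg≡suc = λ _ → pg≡suc
  ... | no  _      = λ ()

  D-complete : ∀ {g h} → p g ≡ suc h → D (g , h) ≡ true
  D-complete {g} {h} = dec-true (p g ≟ suc h)

  labelled⇒nonzero : ∀ {g h} → p g ≡ suc h → p g ≢ zero
  labelled⇒nonzero pg≡suc pg≡0 = 0≢1+n (trans (sym pg≡0) pg≡suc)

  uniqueClassNeighbour : ∀ {g y z h} → Adj G g y → Adj G g z
                       → p y ≡ suc h → p z ≡ suc h → y ≡ z
  uniqueClassNeighbour {g} {h = h} gy gz py pz with p g ≟ zero
  ... | yes pg≡0 = exactlyOne-unique (condA g pg≡0 h) (gy , py) (gz , pz)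
  ... | no  pg≢0 = exactlyOne-unique (condC g pg≢0)
                     (gy , labelled⇒nonzero py) (gz , labelled⇒nonzero pz)

  -- A vertex of V_{j+1} has all its labelled neighbours in V_{j+1}: its unique
  -- neighbour outside V₀ is its partner in the matching ⟨V_{j+1}⟩.
  classNeighbour-sameClass : ∀ {g y h j} → p g ≡ suc j → Adj G g y → p y ≡ suc h → h ≡ j
  classNeighbour-sameClass {g} {y} {j = j} pg gy py =
    let (partner , (g-partner , p-partner) , _) = condB j g pg
        y≡partner = exactlyOne-unique (condC g (labelled⇒nonzero pg))
                      (gy , labelled⇒nonzero py) (g-partner , labelled⇒nonzero p-partner)
    in suc-injective (trans (sym py) (trans (cong p y≡partner) p-partner))

  -- (g , h) is dominated inside its fibre by (g , i) when g ∈ V_{i+1}, i ≠ h,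
  -- and otherwise along a G-edge by a neighbour in V_{h+1} given by (A) or (B).
  covers : ∀ x → Σ (V × Fin r) λ v → D v ≡ true × Adj (G □ K r) v x
  covers (g , h) with p g in pg
  ... | zero = let (y , (gy , py) , _) = condA g pg h
               in (y , h) , D-complete py , inj₁ (adj-sym gy , refl)
  ... | suc i with i ≟ h
  ...   | no  i≢h  = (g , i) , D-complete pg , inj₂ (refl , i≢h)
  ...   | yes refl = let (y , (gy , py) , _) = condB i g pg
                     in (y , i) , D-complete py , inj₁ (adj-sym gy , refl)

  disjoint : ∀ {g₁ h₁ g₂ h₂ x} → p g₁ ≡ suc h₁ → p g₂ ≡ suc h₂ → (g₁ , h₁) ≢ (g₂ , h₂)
           → Adj (G □ K r) (g₁ , h₁) x → Adj (G □ K r) (g₂ , h₂) x → ⊥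
  disjoint p₁ p₂ ne (inj₂ (refl , _)) (inj₂ (refl , _)) =
    ne (cong (_ ,_) (suc-injective (trans (sym p₁) p₂)))
  disjoint p₁ p₂ _  (inj₁ (a₁ , refl)) (inj₂ (refl , h₂≢h₁)) =
    h₂≢h₁ (sym (classNeighbour-sameClass p₂ (adj-sym a₁) p₁))
  disjoint p₁ p₂ _  (inj₂ (refl , h₁≢h₂)) (inj₁ (a₂ , refl)) =
    h₁≢h₂ (sym (classNeighbour-sameClass p₁ (adj-sym a₂) p₂))
  disjoint p₁ p₂ ne (inj₁ (a₁ , refl)) (inj₁ (a₂ , refl)) =
    ne (cong (_, _) (uniqueClassNeighbour (adj-sym a₁) (adj-sym a₂) p₁ p₂))

  isEODSet : IsEODSet (G □ K r) D
  isEODSet = covers , λ _ _ d₁ d₂ ne _ (a₁ , a₂) → disjoint (D-sound d₁) (D-sound d₂) ne a₁ a₂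

module EODToAmenable {V : Set} (_≟V_ : DecidableEquality V) (G : Graph V)
                     {r : ℕ} (r>2 : 2 < r) (D : V × Fin r → Bool)
                     (eod : IsEODSet (G □ K r) D) where

  open Graph G using () renaming (sym to adj-sym; irrefl to adj-irrefl)

  covers : ∀ x → Σ (V × Fin r) λ v → D v ≡ true × Adj (G □ K r) v x
  covers = proj₁ eod

  disjoint : ∀ u v → D u ≡ true → D v ≡ true → u ≢ v
           → ∀ x → ¬ (Adj (G □ K r) u x × Adj (G □ K r) v x)
  disjoint = proj₂ eod

  uniqueInFibre : ∀ {g a b} → D (g , a) ≡ true → D (g , b) ≡ true → a ≡ b
  uniqueInFibre {g} {a} {b} da db with a ≟ b
  ... | yes a≡b = a≡b
  ... | no  a≢b =
    let (c , c≢a , c≢b) = thirdElement r>2 a b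
    in ⊥-elim (disjoint (g , a) (g , b) da db (λ e → a≢b (cong proj₂ e)) (g , c)
                 (inj₂ (refl , ≢-sym c≢a) , inj₂ (refl , ≢-sym c≢b)))

  uniqueInLayer : ∀ {x y z i} → Adj G y x → Adj G z x
                → D (y , i) ≡ true → D (z , i) ≡ true → y ≡ z
  uniqueInLayer {x} {y} {z} {i} yx zx dy dz with y ≟V z
  ... | yes y≡z = y≡z
  ... | no  y≢z = ⊥-elim (disjoint (y , i) (z , i) dy dz (λ e → y≢z (cong proj₁ e)) (x , i)
                            (inj₁ (yx , refl) , inj₁ (zx , refl)))

  label : V → Fin (suc r)
  label g with any? (λ h → D (g , h) BoolProps.≟ true)
  ... | yes (h , _) = suc h
  ... | no  _       = zero

  label-spec : ∀ {g i} → label g ≡ suc i ⇔ D (g , i) ≡ true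
  label-spec {g} {i} with any? (λ h → D (g , h) BoolProps.≟ true)
  ... | yes (h , dh) = mk⇔ (λ e → subst (λ k → D (g , k) ≡ true) (suc-injective e) dh)
                           (λ di → cong suc (uniqueInFibre dh di))
  ... | no  ¬d       = mk⇔ (λ ()) (λ di → ⊥-elim (¬d (i , di)))

  -- If (x , i) is the only possible D-vertex in the fibre of x, then x has
  -- exactly one neighbour labelled suc i: covering (x , i) must use a G-edge.
  uniqueLabelledNeighbour : ∀ x i → (∀ k → D (x , k) ≡ true → k ≡ i)
                          → ExactlyOne (λ y → Adj G x y × label y ≡ suc i)
  uniqueLabelledNeighbour x i onlyI with covers (x , i)
  ... | (_ , k) , dk , inj₂ (refl , k≢i) = contradiction (onlyI k dk) k≢i
  ... | (y , _) , dy , inj₁ (yx , refl) =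
    y , (adj-sym yx , Equivalence.from label-spec dy) ,
    λ z (xz , lz) → uniqueInLayer (adj-sym xz) yx (Equivalence.to label-spec lz) dy

  -- (A) and (B): a vertex of V₀ has no D-vertex in its fibre, a vertex of
  -- V_{i+1} has only (x , i).
  conditionA : ∀ x → label x ≡ zero → (i : Fin r)
             → ExactlyOne (λ y → Adj G x y × label y ≡ suc i)
  conditionA x lx≡0 i = uniqueLabelledNeighbour x i
    (λ k dk → contradiction (trans (sym lx≡0) (Equivalence.from label-spec dk)) 0≢1+n)

  conditionB : (i : Fin r) → IsMatchingOn G (λ x → label x ≡ suc i)
  conditionB i x lx = uniqueLabelledNeighbour x i
    (λ k dk → uniqueInFibre dk (Equivalence.to label-spec lx))

  -- A labelled neighbour z of a vertex x labelled suc i is labelled suc i too: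
  -- otherwise (z , j) and (x , i) in D would share the neighbour (x , j).
  labelledNeighbour-sameLabel : ∀ {x z i j} → label x ≡ suc i → Adj G x z
                              → label z ≡ suc j → j ≡ i
  labelledNeighbour-sameLabel {x} {z} {i} {j} lx xz lz with j ≟ i
  ... | yes j≡i = j≡i
  ... | no  j≢i = ⊥-elim (disjoint (z , j) (x , i)
                    (Equivalence.to label-spec lz) (Equivalence.to label-spec lx)
                    (λ e → adj-irrefl (subst (Adj G x) (cong proj₁ e) xz)) (x , j)
                    (inj₁ (adj-sym xz , refl) , inj₂ (refl , ≢-sym j≢i)))

  -- The partner of x in its own class is its only labelled neighbour.
  conditionC : IsMatchingOn G (λ x → label x ≢ zero)
  conditionC x lx≢0 with nonzero-suc (label x) lx≢0
  ... | i , lx with conditionB i x lx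
  ...   | y , (xy , ly) , onlyY = y , (xy , λ ly≡0 → 0≢1+n (trans (sym ly≡0) ly)) , onlyLabelled
    where
    onlyLabelled : ∀ z → Adj G x z × label z ≢ zero → z ≡ y
    onlyLabelled z (xz , lz≢0) with nonzero-suc (label z) lz≢0
    ... | j , lz = onlyY z (xz , subst (λ k → label z ≡ suc k) (labelledNeighbour-sameLabel lx xz lz) lz)

  isAmenable : IsAmenable r G
  isAmenable = label , conditionA , conditionB , conditionC

mainTheorem2 : (r : ℕ) → 2 < r → (n : ℕ) → (G : Graph (Fin n)) → Decidable (Adj G)
               → IsEOD (G □ K r) ⇔ IsAmenable r G
-- Adjacency need not be decidable: the vertex set Fin n has decidable equality.
mainTheorem2 r r>2 n G _ = mk⇔ eod⇒amenable amenable⇒eod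
  where
  eod⇒amenable : IsEOD (G □ K r) → IsAmenable r G
  eod⇒amenable (D , eod) = EODToAmenable.isAmenable _≟_ G r>2 D eod

  amenable⇒eod : IsAmenable r G → IsEOD (G □ K r)
  amenable⇒eod (p , amenable) = AmenableToEOD.D G p amenable , AmenableToEOD.isEODSet G p amenable
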